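{- Let $G=(V,E)$ be a finite strongly connected directed graph with a total order $<$ on $E$, and $s\in V$. For every $s$-decreasing traversal $\sigma$, the external activity of the arborescence $\Upsilon(\sigma)$ equals the strength of $\sigma$: $e(\Upsilon(\sigma))=\mathrm{str}(\sigma)$.
   Context: An edge-vertex traversal is a sequence $\sigma=(\sigma_i)_{1\le i\le|V|+|E|}$ in which every vertex and edge of $G$ appears exactly once; $\sigma^{<i}=\{\sigma_j:j<i\}$. It is $s$-decreasing if (R1) whenever $\sigma_i\in V\setminus\{s\}$, $\sigma_{i-1}$ is an edge with target $\sigma_i$; and (R2) whenever $\sigma_i$ is an edge, it is the $<$-largest among edges not in $\sigma^{<i}$ whose source lies in $\sigma^{<i}$. An edge $\sigma_i$ is strong if its target is $\sigma_j$ for some $j<i$; $\mathrm{str}(\sigma)$ is the number of strong edges. $\Upsilon(\sigma)$ is the subgraph with vertex set $V$ and edge set $\{\sigma_{i-1}:\sigma_i\in V\setminus\{s\}\}$; it is an arborescence rooted at $s$ (a subgraph with vertex set $V$ containing for each $v$ a unique directed path from $s$ to $v$, where a directed path is $v_0e_0\dots e_{k-1}v_k$ with distinct vertices and $e_i$ from $v_i$ to $v_{i+1}$). For an arborescence $T$ and $e\in E\setminus E(T)$, there are exactly two edge-disjoint directed paths $P_1,P_2$ in $(V,E(T)\cup\{e\})$ with a common starting vertex and both ending at the target of $e$, $P_1$ containing $e$; $e$ is externally active if the $<$-smallest edge of $E(P_1)\cup E(P_2)$ lies in $P_1$; $e(T)$ is the number of externally active edges. -}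

module Defs where

open import Level using (0ℓ)
open import Data.Nat using (ℕ; suc; _<_; _+_)
open import Data.Fin using (Fin; toℕ)
open import Data.Sum using (_⊎_; inj₁; inj₂)
open import Data.Product using (Σ; ∃; ∃-syntax; _×_; _,_)
open import Data.Unit using (⊤)
open import Data.List using (List; []; _∷_; map; length; _++_)
open import Data.List.Membership.Propositional using (_∈_)
open import Data.List.Relation.Unary.All using (All)
open import Data.List.Relation.Unary.Unique.Propositional using (Unique)
open import Relation.Binary.Core using (Rel)
open import Relation.Binary.PropositionalEquality using (_≡_; _≢_)
open import Relation.Nullary using (¬_)
open import Function.Bundles using (_⇔_)
open import Function.Definitions using (Bijective)

record Digraph : Set where
  field
    nV  : ℕ
    nE  : ℕ
    src : Fin nE → Fin nV
    tgt : Fin nE → Fin nV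

module _ (G : Digraph) where
  open Digraph G

  Vtx : Set
  Vtx = Fin nV

  Edg : Set
  Edg = Fin nE

  Linked : Vtx → List Edg → Vtx → Set
  Linked w []       v = w ≡ v
  Linked w (e ∷ es) v = src e ≡ w × Linked (tgt e) es v

  IsPath : (Edg → Set) → Vtx → List Edg → Vtx → Set
  IsPath allowed w es v =
    Linked w es v × All allowed es × Unique (map src es) × Unique (map tgt es)

  StronglyConnected : Set
  StronglyConnected = ∀ u v → ∃[ es ] IsPath (λ _ → ⊤) u es v

  Item : Set
  Item = Vtx ⊎ Edg

  Traversal : Set
  Traversal = Σ (Fin (nV + nE) → Item) (Bijective _≡_ _≡_)

  module _ (σ : Fin (nV + nE) → Item) where

    Before : Fin (nV + nE) → Item → Set
    Before i x = ∃[ j ] (toℕ j < toℕ i × σ j ≡ x)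

    Candidate : Fin (nV + nE) → Edg → Set
    Candidate i f = ¬ Before i (inj₂ f) × Before i (inj₁ (src f))

  module _ (_≺_ : Rel Edg 0ℓ) (s : Vtx) where

    SDecreasing : Traversal → Set
    SDecreasing (σ , _) =
      (∀ i v → σ i ≡ inj₁ v → v ≢ s →
         ∃[ j ] (suc (toℕ j) ≡ toℕ i × ∃[ e ] (σ j ≡ inj₂ e × tgt e ≡ v)))
      × (∀ i e → σ i ≡ inj₂ e →
           Candidate σ i e × (∀ f → Candidate σ i f → f ≡ e ⊎ f ≺ e))

    InΥ : Traversal → Edg → Set
    InΥ (σ , _) e =
      ∃[ j ] ∃[ i ] (suc (toℕ j) ≡ toℕ i × σ j ≡ inj₂ e
                     × ∃[ v ] (σ i ≡ inj₁ v × v ≢ s))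

    Strong : Traversal → Edg → Set
    Strong (σ , _) e = ∃[ i ] (σ i ≡ inj₂ e × Before σ i (inj₁ (tgt e)))

    ExternallyActive : (Edg → Set) → Edg → Set
    ExternallyActive T e =
      ¬ T e ×
      ∃[ w ] ∃[ p₁ ] ∃[ p₂ ]
        ( IsPath (λ f → T f ⊎ f ≡ e) w p₁ (tgt e)
        × IsPath (λ f → T f ⊎ f ≡ e) w p₂ (tgt e)
        × e ∈ p₁
        × (∀ f → f ∈ p₁ → ¬ f ∈ p₂)
        × ∃[ e₀ ] (e₀ ∈ p₁ × (∀ f → f ∈ p₁ ++ p₂ → f ≡ e₀ ⊎ e₀ ≺ f)))

  IsCard : (Edg → Set) → ℕ → Set
  IsCard P k = ∃[ xs ] (Unique xs × (∀ e → (e ∈ xs) ⇔ P e) × length xs ≡ k)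

-- Write τ for positions in σ.  By (R1) each edge of Υ(σ) is immediately followed by its
-- target, and by (R2) an edge f whose source precedes e while f itself follows e satisfies
-- f ≺ e.  From these two facts, e is externally active iff τ(tgt e) < τ(e), i.e. iff e is
-- strong: for such e the paths are the Υ-paths from the nearest common ancestor of src e
-- and tgt e, and an active e with τ(e) < τ(tgt e) would make the Υ-path P₂ jump over the
-- least edge of P₁.
module Submission where

open import Defs
open import Level using (0ℓ)
open import Data.Nat using (ℕ; suc; _<_; _≤_; _+_; _<?_; z≤n)
open import Data.Nat.Properties
  using (<-cmp; ≤∧≢⇒<; <-asym; <-irrefl; <-trans; <-≤-trans; ≤-<-trans; ≤-trans;
         ≤-refl; ≤-pred; n<1+n; suc-injective; +-monoˡ-<; +-comm; <⇒≤)
open import Data.Fin using (Fin; toℕ; fromℕ<)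
open import Data.Fin.Properties using (toℕ-injective; toℕ<n; toℕ-fromℕ<; _≟_)
open import Data.Sum using (_⊎_; inj₁; inj₂; [_,_]′)
open import Data.Sum.Properties using (inj₂-injective)
open import Data.Product using (Σ; ∃; ∃-syntax; _×_; _,_; proj₁; proj₂)
open import Data.List using (List; []; _∷_; _++_; map; filter; allFin; length)
open import Data.List.Properties using (map-++)
open import Data.List.Membership.Propositional using (_∈_; _∉_)
open import Data.List.Membership.Propositional.Properties
  using (∈-++⁻; ∈-++⁺ˡ; ∈-++⁺ʳ; ∈-map⁻; ∈-filter⁺; ∈-filter⁻; ∈-allFin)
open import Data.List.Relation.Unary.Any using (here; there)
open import Data.List.Relation.Unary.All as All using (All; []; _∷_)
open import Data.List.Relation.Unary.All.Properties using (++⁺)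
open import Data.List.Relation.Unary.AllPairs as AllPairs using (AllPairs; []; _∷_)
import Data.List.Relation.Unary.AllPairs.Properties as AllPairs
open import Data.List.Relation.Unary.Unique.Propositional using (Unique)
import Data.List.Relation.Unary.Unique.Propositional.Properties as Unique
open import Data.List.Relation.Binary.Disjoint.Propositional using (Disjoint)
import Data.List.Relation.Binary.Disjoint.Propositional.Properties as Disjoint
open import Data.Empty using (⊥-elim)
open import Function.Base using (id)
open import Function.Bundles using (_⇔_; mk⇔)
open import Function.Definitions using (Bijective)
import Function.Properties.Equivalence as ⇔
open import Relation.Binary.Core using (Rel)
open import Relation.Binary.Bundles using (TotalOrder)
open import Relation.Binary.Structures using (IsStrictTotalOrder)
open import Relation.Binary.Definitions using (tri<; tri≈; tri>)
import Relation.Binary.Construct.StrictToNonStrict as StrictToNonStrict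
open import Relation.Binary.PropositionalEquality
  using (_≡_; _≢_; refl; sym; trans; cong; subst; module ≡-Reasoning)
open import Relation.Nullary using (¬_; yes; no)
open import Relation.Unary using (Decidable)

unique-∷ʳ : {A : Set} {xs : List A} {x : A} → Unique xs → x ∉ xs → Unique (xs ++ x ∷ [])
unique-∷ʳ u x∉xs = Unique.++⁺ u ([] ∷ []) λ { (x∈xs , here refl) → x∉xs x∈xs }

module _ {A : Set} {_<_ : Rel A 0ℓ} (sto : IsStrictTotalOrder _≡_ _<_) where

  Least : A → List A → Set
  Least m xs = ∀ x → x ∈ xs → x ≡ m ⊎ m < x

  least-exists : ∀ {x} xs → x ∈ xs → ∃ λ m → m ∈ xs × Least m xs
  least-exists (y ∷ ys) _ = minimum , minimum∈ , minimum-least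
    where
    totalOrder : TotalOrder 0ℓ 0ℓ 0ℓ
    totalOrder = record { isTotalOrder = StrictToNonStrict.isTotalOrder _≡_ _<_ sto }
    open import Data.List.Extrema totalOrder using (min; argmin-sel; min≤⊤; min≤xs)

    minimum : A
    minimum = min y ys

    minimum∈ : minimum ∈ y ∷ ys
    minimum∈ with argmin-sel id y ys
    ... | inj₁ eq = here eq
    ... | inj₂ m∈ys = there m∈ys

    flip-≤ : ∀ {x} → minimum < x ⊎ minimum ≡ x → x ≡ minimum ⊎ minimum < x
    flip-≤ (inj₁ lt) = inj₂ lt
    flip-≤ (inj₂ eq) = inj₁ (sym eq)

    minimum-least : Least minimum (y ∷ ys)
    minimum-least x (here refl) = flip-≤ (min≤⊤ y ys)
    minimum-least x (there x∈ys) = flip-≤ (All.lookup (min≤xs y ys) x∈ys)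

module Walks (G : Digraph) where
  open Digraph G

  Linked-++ : ∀ {x as y bs z} → Linked G x as y → Linked G y bs z → Linked G x (as ++ bs) z
  Linked-++ {as = []} refl l = l
  Linked-++ {as = a ∷ as} (src≡ , l) l' = src≡ , Linked-++ l l'

  Linked-end : ∀ {x gs y} → Linked G x gs y → x ≡ y ⊎ ∃ λ g → g ∈ gs × tgt g ≡ y
  Linked-end {gs = []} x≡y = inj₁ x≡y
  Linked-end {gs = g ∷ gs} (_ , l) with Linked-end l
  ... | inj₁ eq = inj₂ (g , here refl , eq)
  ... | inj₂ (h , h∈ , eq) = inj₂ (h , there h∈ , eq)

module Counting (G : Digraph) where
  open Digraph G

  module _ {P : Edg G → Set} (P? : Decidable P) where

    IsCard-filter : IsCard G P (length (filter P? (allFin nE)))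
    IsCard-filter =
      filter P? (allFin nE) , Unique.filter⁺ P? (Unique.allFin⁺ nE) ,
      (λ e → mk⇔ (λ e∈ → proj₂ (∈-filter⁻ P? {xs = allFin nE} e∈))
                 (λ pe → ∈-filter⁺ P? (∈-allFin e) pe)) ,
      refl

  IsCard-cong : ∀ {P Q : Edg G → Set} {k} → (∀ e → P e ⇔ Q e) → IsCard G P k → IsCard G Q k
  IsCard-cong P⇔Q (xs , u , ∈⇔P , len) = xs , u , (λ e → ⇔.trans (∈⇔P e) (P⇔Q e)) , len

module TraversalPositions (G : Digraph) (σ : Fin (Digraph.nV G + Digraph.nE G) → Item G)
                          (bij : Bijective _≡_ _≡_ σ) where
  open Digraph G

  pos : Item G → Fin (nV + nE)
  pos y = proj₁ (proj₂ bij y)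

  σ-pos : ∀ y → σ (pos y) ≡ y
  σ-pos y = proj₂ (proj₂ bij y) refl

  τ : Item G → ℕ
  τ y = toℕ (pos y)

  τv : Vtx G → ℕ
  τv x = τ (inj₁ x)

  τe : Edg G → ℕ
  τe e = τ (inj₂ e)

  τ-injective : ∀ {y z} → τ y ≡ τ z → y ≡ z
  τ-injective {y} {z} eq = begin
    y            ≡⟨ sym (σ-pos y) ⟩
    σ (pos y)    ≡⟨ cong σ (toℕ-injective eq) ⟩
    σ (pos z)    ≡⟨ σ-pos z ⟩
    z            ∎
    where open ≡-Reasoning

  τv≢τe : ∀ {x e} → τv x ≢ τe e
  τv≢τe eq with τ-injective eq
  ... | ()

  τ-at : ∀ {i y} → σ i ≡ y → τ y ≡ toℕ i
  τ-at {i} refl = cong toℕ (proj₁ bij (σ-pos (σ i)))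

  Before⇒τ< : ∀ {i y} → Before G σ i y → τ y < toℕ i
  Before⇒τ< {i} (j , j<i , σj≡y) = subst (_< toℕ i) (sym (τ-at σj≡y)) j<i

  τ<⇒Before : ∀ {i y} → τ y < toℕ i → Before G σ i y
  τ<⇒Before {y = y} lt = pos y , lt , σ-pos y

  Forward : Edg G → Set
  Forward g = τv (src g) < τe g × τe g < τv (tgt g)

  forward-< : ∀ {g} → Forward g → τv (src g) < τv (tgt g)
  forward-< (src<g , g<tgt) = <-trans src<g g<tgt

  forward-walk-bounds : ∀ {x gs y} → Linked G x gs y → All Forward gs → ∀ {f} → f ∈ gs →
                        τv x ≤ τv (src f) × τv (tgt f) ≤ τv y
  forward-walk-bounds (refl , l) (_ ∷ fs) (here refl) = ≤-refl , forward-walk-≤ l fs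
    where
    forward-walk-≤ : ∀ {x gs y} → Linked G x gs y → All Forward gs → τv x ≤ τv y
    forward-walk-≤ {gs = []} refl [] = ≤-refl
    forward-walk-≤ {gs = g ∷ gs} (refl , l) (fw ∷ fs) =
      ≤-trans (<⇒≤ (forward-< fw)) (forward-walk-≤ l fs)
  forward-walk-bounds {gs = g ∷ gs} (refl , l) (fw ∷ fs) (there f∈)
    with forward-walk-bounds l fs f∈
  ... | lower , upper = ≤-trans (<⇒≤ (forward-< fw)) lower , upper

  forward-walk-ascending : ∀ {x gs y} → Linked G x gs y → All Forward gs →
    AllPairs (λ f g → τv (src f) < τv (src g) × τv (tgt f) < τv (tgt g)) gs
  forward-walk-ascending {gs = []} _ _ = []
  forward-walk-ascending {gs = g ∷ gs} (refl , l) (fw ∷ fs) =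
    All.tabulate (λ f∈ → let tgt-g≤src-f = proj₁ (forward-walk-bounds l fs f∈) in
                           <-≤-trans (forward-< fw) tgt-g≤src-f ,
                           ≤-<-trans tgt-g≤src-f (forward-< (All.lookup fs f∈)))
    ∷ forward-walk-ascending l fs

  forward-walk-isPath : ∀ {P x gs y} → Linked G x gs y → All Forward gs → All P gs →
                        IsPath G P x gs y
  forward-walk-isPath {gs = gs} linked forward allowed =
    linked , allowed , distinct (λ f<g → proj₁ f<g) , distinct (λ f<g → proj₂ f<g)
    where
    distinct : ∀ {h : Edg G → Vtx G} →
               (∀ {f g} → τv (src f) < τv (src g) × τv (tgt f) < τv (tgt g) → τv (h f) < τv (h g)) →
               Unique (map h gs)
    distinct increasing =
      AllPairs.map⁺ (AllPairs.map (λ f<g hf≡hg → <-irrefl (cong τv hf≡hg) (increasing f<g))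
                                  (forward-walk-ascending linked forward))

module DecreasingTraversal
  (G : Digraph) (_≺_ : Rel (Edg G) 0ℓ) (sto : IsStrictTotalOrder _≡_ _≺_) (s : Vtx G)
  (σ : Fin (Digraph.nV G + Digraph.nE G) → Item G) (bij : Bijective _≡_ _≡_ σ)
  (sd : SDecreasing G _≺_ s (σ , bij)) where

  open Digraph G
  open IsStrictTotalOrder sto using (asym)
  open Walks G
  open TraversalPositions G σ bij
  open Σ sd using () renaming (proj₁ to R1; proj₂ to R2)

  Υ : Edg G → Set
  Υ = InΥ G _≺_ s (σ , bij)

  src-before : ∀ e → τv (src e) < τe e
  src-before e = Before⇒τ< (proj₂ (proj₁ (R2 (pos (inj₂ e)) e (σ-pos _))))

  Straddles : Edg G → Edg G → Set
  Straddles f e = τv (src f) < τe e × τe e < τe f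

  -- When e was chosen, f was available (source visited, f itself not yet), so (R2) gives f ≺ e.
  straddles⇒≺ : ∀ {f e} → Straddles f e → f ≺ e
  straddles⇒≺ {f} {e} (src<e , e<f)
    with proj₂ (R2 (pos (inj₂ e)) e (σ-pos _)) f
               ((λ f-before → <-asym (Before⇒τ< f-before) e<f) , τ<⇒Before src<e)
  ... | inj₁ refl = ⊥-elim (<-irrefl refl e<f)
  ... | inj₂ f≺e = f≺e

  least-unstraddled : ∀ {m xs f} → Least sto m xs → f ∈ xs → ¬ Straddles f m
  least-unstraddled least f∈ straddle with least _ f∈
  ... | inj₁ refl = <-irrefl refl (proj₂ straddle)
  ... | inj₂ m≺f = asym m≺f (straddles⇒≺ straddle)

  Υ-target-next : ∀ {g} → Υ g → τv (tgt g) ≡ suc (τe g)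
  Υ-target-next {g} (j , i , j+1≡i , σj≡g , v , σi≡v , v≢s) with R1 i v σi≡v v≢s
  ... | j' , j'+1≡i , g' , σj'≡g' , tgt-g'≡v = begin
    τv (tgt g)     ≡⟨ cong τv tgt-g≡v ⟩
    τv v           ≡⟨ τ-at σi≡v ⟩
    toℕ i          ≡⟨ sym j+1≡i ⟩
    suc (toℕ j)    ≡⟨ cong suc (sym (τ-at σj≡g)) ⟩
    suc (τe g)     ∎
    where
    open ≡-Reasoning
    j'≡j : j' ≡ j
    j'≡j = toℕ-injective (suc-injective (trans j'+1≡i (sym j+1≡i)))
    g'≡g : g' ≡ g
    g'≡g = inj₂-injective (trans (sym σj'≡g') (trans (cong σ j'≡j) σj≡g))
    tgt-g≡v : tgt g ≡ v
    tgt-g≡v = subst (λ h → tgt h ≡ v) g'≡g tgt-g'≡v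

  Υ-forward : ∀ {g} → Υ g → Forward g
  Υ-forward {g} g∈Υ = src-before g , subst (τe g <_) (sym (Υ-target-next g∈Υ)) (n<1+n _)

  Υ-target-injective : ∀ {g g'} → Υ g → Υ g' → tgt g ≡ tgt g' → g ≡ g'
  Υ-target-injective g∈Υ g'∈Υ eq = inj₂-injective (τ-injective (suc-injective
    (trans (sym (Υ-target-next g∈Υ)) (trans (cong τv eq) (Υ-target-next g'∈Υ)))))

  Υ-parent : ∀ x → x ≢ s → ∃ λ g → Υ g × tgt g ≡ x
  Υ-parent x x≢s with R1 (pos (inj₁ x)) x (σ-pos _) x≢s
  ... | j , j+1≡i , g , σj≡g , tgt-g≡x =
    g , (j , pos (inj₁ x) , j+1≡i , σj≡g , x , σ-pos _ , x≢s) , tgt-g≡x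

  position-zero-is-root : ∀ i → toℕ i ≡ 0 → σ i ≡ inj₁ s
  position-zero-is-root i i≡0 with σ i in σi≡
  ... | inj₂ f with subst (τv (src f) <_) i≡0 (Before⇒τ< (proj₂ (proj₁ (R2 i f σi≡))))
  ...   | ()
  position-zero-is-root i i≡0 | inj₁ v with v ≟ s
  ...   | yes refl = refl
  ...   | no v≢s with R1 i v σi≡ v≢s
  ...     | j , j+1≡i , _ with trans j+1≡i i≡0
  ...       | ()

  root-first : τv s ≡ 0
  root-first = trans (τ-at (position-zero-is-root i₀ (toℕ-fromℕ< _))) (toℕ-fromℕ< _)
    where
    i₀ : Fin (nV + nE)
    i₀ = fromℕ< (≤-<-trans z≤n (toℕ<n (pos (inj₁ s))))

  -- Each Υ-edge is immediately followed in σ by its target, so a Υ-walk cannot jump over μ.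
  Υ-walk-straddles : ∀ μ {x gs y} → Linked G x gs y → All Υ gs → μ ∉ gs →
                     τv x < τe μ → τe μ < τv y → ∃ λ f → f ∈ gs × Straddles f μ
  Υ-walk-straddles μ {gs = []} refl _ _ x<μ μ<x = ⊥-elim (<-asym x<μ μ<x)
  Υ-walk-straddles μ {gs = g ∷ gs} (refl , l) (g∈Υ ∷ gs⊆Υ) μ∉ src<μ μ<y with <-cmp (τe μ) (τe g)
  ... | tri< μ<g _ _ = g , here refl , src<μ , μ<g
  ... | tri≈ _ μ≡g _ = ⊥-elim (μ∉ (here (inj₂-injective (τ-injective μ≡g))))
  ... | tri> _ _ g<μ with Υ-walk-straddles μ l gs⊆Υ (λ μ∈ → μ∉ (there μ∈)) tgt<μ μ<y
    where
    tgt<μ : τv (tgt g) < τe μ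
    tgt<μ = ≤∧≢⇒< (subst (_≤ τe μ) (sym (Υ-target-next g∈Υ)) g<μ) τv≢τe
  ...   | f , f∈ , straddle = f , there f∈ , straddle

  record CommonAncestor (x y : Vtx G) : Set where
    field
      apex : Vtx G
      pathˡ pathʳ : List (Edg G)
      linkedˡ : Linked G apex pathˡ x
      linkedʳ : Linked G apex pathʳ y
      treeˡ : All Υ pathˡ
      treeʳ : All Υ pathʳ
      disjoint : Disjoint pathˡ pathʳ

    forwardˡ : All Forward pathˡ
    forwardˡ = All.map Υ-forward treeˡ

    forwardʳ : All Forward pathʳ
    forwardʳ = All.map Υ-forward treeʳ

  common-ancestor-refl : ∀ x → CommonAncestor x x
  common-ancestor-refl x = record
    { apex = x ; pathˡ = [] ; pathʳ = [] ; linkedˡ = refl ; linkedʳ = refl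
    ; treeˡ = [] ; treeʳ = [] ; disjoint = λ { (() , _) } }

  common-ancestor-sym : ∀ {x y} → CommonAncestor x y → CommonAncestor y x
  common-ancestor-sym a = record
    { apex = apex ; pathˡ = pathʳ ; pathʳ = pathˡ ; linkedˡ = linkedʳ ; linkedʳ = linkedˡ
    ; treeˡ = treeʳ ; treeʳ = treeˡ ; disjoint = Disjoint.sym disjoint }
    where open CommonAncestor a

  common-ancestor-extend : ∀ {g y} → Υ g → τv y < τv (tgt g) →
                           CommonAncestor (src g) y → CommonAncestor (tgt g) y
  common-ancestor-extend {g} {y} g∈Υ y<tgt a = record
    { apex = apex ; pathˡ = pathˡ ++ g ∷ [] ; pathʳ = pathʳ
    ; linkedˡ = Linked-++ linkedˡ (refl , refl) ; linkedʳ = linkedʳ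
    ; treeˡ = ++⁺ treeˡ (g∈Υ ∷ []) ; treeʳ = treeʳ ; disjoint = disjoint' }
    where
    open CommonAncestor a
    disjoint' : Disjoint (pathˡ ++ g ∷ []) pathʳ
    disjoint' (f∈ˡ , f∈ʳ) with ∈-++⁻ pathˡ f∈ˡ
    ... | inj₁ f∈pathˡ = disjoint (f∈pathˡ , f∈ʳ)
    ... | inj₂ (here refl) =
      <-irrefl refl (<-≤-trans y<tgt (proj₂ (forward-walk-bounds linkedʳ forwardʳ f∈ʳ)))

  not-root : ∀ {x y} → τv y < τv x → x ≢ s
  not-root y<x refl = <-irrefl refl (≤-<-trans (subst (_≤ _) (sym root-first) z≤n) y<x)

  common-ancestor-bounded : ∀ n x y → τv x + τv y < n → CommonAncestor x y
  common-ancestor-bounded (suc n) x y x+y≤n with <-cmp (τv x) (τv y)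
  ... | tri≈ _ x≡y _ with τ-injective x≡y
  ...   | refl = common-ancestor-refl x
  common-ancestor-bounded (suc n) x y x+y≤n | tri> _ _ y<x with Υ-parent x (not-root y<x)
  ... | g , g∈Υ , refl = common-ancestor-extend g∈Υ y<x
          (common-ancestor-bounded n (src g) y
            (<-≤-trans (+-monoˡ-< (τv y) (forward-< (Υ-forward g∈Υ))) (≤-pred x+y≤n)))
  common-ancestor-bounded (suc n) x y x+y≤n | tri< x<y _ _ with Υ-parent y (not-root x<y)
  ... | g , g∈Υ , refl = common-ancestor-sym (common-ancestor-extend g∈Υ x<y
          (common-ancestor-bounded n (src g) x
            (<-≤-trans (+-monoˡ-< (τv x) (forward-< (Υ-forward g∈Υ)))
                       (≤-pred (subst (_< suc n) (+-comm (τv x) (τv y)) x+y≤n)))))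

  common-ancestor : ∀ x y → CommonAncestor x y
  common-ancestor x y = common-ancestor-bounded (suc (τv x + τv y)) x y (n<1+n _)

  Backward : Edg G → Set
  Backward e = τv (tgt e) < τe e

  strong⇔backward : ∀ e → Strong G _≺_ s (σ , bij) e ⇔ Backward e
  strong⇔backward e = mk⇔
    (λ { (i , σi≡e , tgt-before) → subst (τv (tgt e) <_) (sym (τ-at σi≡e)) (Before⇒τ< tgt-before) })
    (λ tgt<e → pos (inj₂ e) , σ-pos _ , τ<⇒Before tgt<e)

  Active : Edg G → Set
  Active = ExternallyActive G _≺_ s Υ

  active⇒backward : ∀ e → Active e → Backward e
  active⇒backward e (_ , w , p₁ , p₂ , (linked₁ , allowed₁ , _) , (linked₂ , allowed₂ , _) ,
                     e∈p₁ , disjoint , e₀ , e₀∈p₁ , least) with <-cmp (τv (tgt e)) (τe e)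
  ... | tri< tgt<e _ _ = tgt<e
  ... | tri≈ _ tgt≡e _ = ⊥-elim (τv≢τe tgt≡e)
  ... | tri> _ _ e<tgt with Υ-walk-straddles e₀ linked₂ p₂⊆Υ (disjoint e₀ e₀∈p₁)
                             (≤-<-trans (proj₁ bounds) (proj₁ (All.lookup forward₁ e₀∈p₁)))
                             (<-≤-trans (proj₂ (All.lookup forward₁ e₀∈p₁)) (proj₂ bounds))
    where
    forward : ∀ {f} → Υ f ⊎ f ≡ e → Forward f
    forward (inj₁ f∈Υ) = Υ-forward f∈Υ
    forward (inj₂ refl) = src-before e , e<tgt
    forward₁ : All Forward p₁
    forward₁ = All.map forward allowed₁
    bounds : τv w ≤ τv (src e₀) × τv (tgt e₀) ≤ τv (tgt e)
    bounds = forward-walk-bounds linked₁ forward₁ e₀∈p₁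
    p₂⊆Υ : All Υ p₂
    p₂⊆Υ = All.tabulate λ f∈p₂ →
      [ id , (λ { refl → ⊥-elim (disjoint e e∈p₁ f∈p₂) }) ]′ (All.lookup allowed₂ f∈p₂)
  ... | f , f∈p₂ , straddle = ⊥-elim (least-unstraddled least (∈-++⁺ʳ p₁ f∈p₂) straddle)

  backward-∉Υ : ∀ {e} → Backward e → ¬ Υ e
  backward-∉Υ tgt<e e∈Υ = <-asym tgt<e (proj₂ (Υ-forward e∈Υ))

  module _ {e} (tgt<e : Backward e) (a : CommonAncestor (src e) (tgt e)) where
    open CommonAncestor a

    ancestor-path-through : IsPath G (λ f → Υ f ⊎ f ≡ e) apex (pathˡ ++ e ∷ []) (tgt e)
    ancestor-path-through =
      Linked-++ linkedˡ (refl , refl) , ++⁺ (All.map inj₁ treeˡ) (inj₂ refl ∷ []) ,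
      subst Unique (sym (map-++ src pathˡ (e ∷ []))) (unique-∷ʳ unique-srcs src∉pathˡ) ,
      subst Unique (sym (map-++ tgt pathˡ (e ∷ []))) (unique-∷ʳ unique-tgts tgt∉pathˡ)
      where
      unique-srcs : Unique (map src pathˡ)
      unique-srcs = proj₁ (proj₂ (proj₂ (forward-walk-isPath linkedˡ forwardˡ treeˡ)))
      unique-tgts : Unique (map tgt pathˡ)
      unique-tgts = proj₂ (proj₂ (proj₂ (forward-walk-isPath linkedˡ forwardˡ treeˡ)))
      src∉pathˡ : src e ∉ map src pathˡ
      src∉pathˡ src∈ with ∈-map⁻ src src∈
      ... | f , f∈ , src-e≡src-f = <-irrefl (cong τv (sym src-e≡src-f))
        (<-≤-trans (forward-< (All.lookup forwardˡ f∈))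
                   (proj₂ (forward-walk-bounds linkedˡ forwardˡ f∈)))
      tgt∉pathˡ : tgt e ∉ map tgt pathˡ
      tgt∉pathˡ tgt∈ with ∈-map⁻ tgt tgt∈ | Linked-end linkedʳ
      ... | f , f∈ , tgt-e≡tgt-f | inj₁ apex≡tgt = <-irrefl (cong τv (trans apex≡tgt tgt-e≡tgt-f))
        (≤-<-trans (proj₁ (forward-walk-bounds linkedˡ forwardˡ f∈))
                   (forward-< (All.lookup forwardˡ f∈)))
      ... | f , f∈ , tgt-e≡tgt-f | inj₂ (g , g∈ , tgt-g≡tgt-e) = disjoint (f∈ ,
        subst (_∈ pathʳ) (Υ-target-injective (All.lookup treeʳ g∈) (All.lookup treeˡ f∈)
                                             (trans tgt-g≡tgt-e tgt-e≡tgt-f)) g∈)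

    -- Otherwise m would be jumped over by the Υ-part of P₁ (if τ(m) < τ(src e)) or by e.
    least-∉pathʳ : ∀ {m} → Least sto m ((pathˡ ++ e ∷ []) ++ pathʳ) → m ∉ pathʳ
    least-∉pathʳ {m} least m∈ʳ with <-cmp (τe m) (τv (src e))
    ... | tri≈ _ m≡src _ = τv≢τe (sym m≡src)
    ... | tri> _ _ src<m = least-unstraddled least (∈-++⁺ˡ (∈-++⁺ʳ pathˡ (here refl))) (src<m , m<e)
      where
      m<e : τe m < τe e
      m<e = <-trans (<-≤-trans (proj₂ (All.lookup forwardʳ m∈ʳ))
                               (proj₂ (forward-walk-bounds linkedʳ forwardʳ m∈ʳ))) tgt<e
    ... | tri< m<src _ _
      with Υ-walk-straddles m linkedˡ treeˡ (λ m∈ˡ → disjoint (m∈ˡ , m∈ʳ))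
             (≤-<-trans (proj₁ (forward-walk-bounds linkedʳ forwardʳ m∈ʳ)) (src-before m)) m<src
    ...   | f , f∈ˡ , straddle = least-unstraddled least (∈-++⁺ˡ (∈-++⁺ˡ f∈ˡ)) straddle

  backward⇒active : ∀ e → Backward e → Active e
  backward⇒active e tgt<e =
    backward-∉Υ tgt<e , apex , pathˡ ++ e ∷ [] , pathʳ ,
    ancestor-path-through tgt<e a , forward-walk-isPath linkedʳ forwardʳ (All.map inj₁ treeʳ) ,
    e∈p₁ , p₁-disjoint-pathʳ , least-on-p₁
    where
    a : CommonAncestor (src e) (tgt e)
    a = common-ancestor (src e) (tgt e)
    open CommonAncestor a
    e∈p₁ : e ∈ pathˡ ++ e ∷ []
    e∈p₁ = ∈-++⁺ʳ pathˡ (here refl)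
    p₁-disjoint-pathʳ : ∀ f → f ∈ pathˡ ++ e ∷ [] → f ∉ pathʳ
    p₁-disjoint-pathʳ f f∈p₁ f∈ʳ with ∈-++⁻ pathˡ f∈p₁
    ... | inj₁ f∈ˡ = disjoint (f∈ˡ , f∈ʳ)
    ... | inj₂ (here refl) = backward-∉Υ tgt<e (All.lookup treeʳ f∈ʳ)
    least-on-p₁ : ∃ λ e₀ → e₀ ∈ pathˡ ++ e ∷ [] × Least sto e₀ ((pathˡ ++ e ∷ []) ++ pathʳ)
    least-on-p₁ with least-exists sto ((pathˡ ++ e ∷ []) ++ pathʳ) (∈-++⁺ˡ e∈p₁)
    ... | m , m∈ , least with ∈-++⁻ (pathˡ ++ e ∷ []) m∈
    ...   | inj₁ m∈p₁ = m , m∈p₁ , least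
    ...   | inj₂ m∈ʳ = ⊥-elim (least-∉pathʳ tgt<e a least m∈ʳ)

lemma6p4 : (G : Digraph) → StronglyConnected G →
    (_≺_ : Rel (Edg G) 0ℓ) → IsStrictTotalOrder _≡_ _≺_ →
    (s : Vtx G) → (σ : Traversal G) → SDecreasing G _≺_ s σ →
    ∃[ k ] (IsCard G (ExternallyActive G _≺_ s (InΥ G _≺_ s σ)) k
    × IsCard G (Strong G _≺_ s σ) k)
lemma6p4 G _ _≺_ sto s (σ , bij) sd =
  length (filter backward? (allFin nE)) ,
  IsCard-cong (λ e → mk⇔ (backward⇒active e) (active⇒backward e)) (IsCard-filter backward?) ,
  IsCard-cong (λ e → ⇔.sym (strong⇔backward e)) (IsCard-filter backward?)
  where
  open Digraph G
  open Counting G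
  open TraversalPositions G σ bij
  open DecreasingTraversal G _≺_ sto s σ bij sd
  backward? : Decidable Backward
  backward? e = τv (tgt e) <? τe e
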